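{- There is a constant $c>0$ such that for every $k\ge 1$, every parity decision tree that computes $\mathsf{MAJ}_3^{\otimes k}$ has depth at least $c\cdot 2.25^k$; i.e., the parity decision tree depth of $\mathsf{MAJ}_3^{\otimes k}$ is $\Omega(2.25^k)$.
   Context: $\mathsf{MAJ}_3:\{ -1,1\}^3\to\{ -1,1\}$ is $\mathsf{MAJ}_3(x)=(-1)^{\mathbf{1}[x_1+x_2+x_3<0]}$. Set $\mathsf{MAJ}_3^{\otimes 1}=\mathsf{MAJ}_3$ and for $k\ge 2$ define $\mathsf{MAJ}_3^{\otimes k}:\{ -1,1\}^{3^k}\to\{ -1,1\}$ by $\mathsf{MAJ}_3^{\otimes k}(x)=\mathsf{MAJ}_3\big(\mathsf{MAJ}_3^{\otimes k-1}(x_{\{1,\dots,3^{k-1}\}}),\mathsf{MAJ}_3^{\otimes k-1}(x_{\{3^{k-1}+1,\dots,2\cdot3^{k-1}\}}),\mathsf{MAJ}_3^{\otimes k-1}(x_{\{2\cdot3^{k-1}+1,\dots,3^k\}})\big)$. A parity decision tree is a rooted full binary tree in which each internal node is labelled by a set $S\subseteq[n]$, the two edges to its children are labelled $-1$ and $1$, and each leaf is labelled by a value in $\{ -1,1\}$; an input $x$ follows, at a node labelled $S$, the edge labelled $\prod_{i\in S}x_i$. The tree computes $f$ if every input $x$ reaches a leaf labelled $f(x)$. Depth is the maximum number of internal nodes on a root-to-leaf path. -}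

module Defs where

open import Data.Nat using (ℕ; zero; suc; _+_; _*_; _^_; _⊔_)
open import Data.Integer as ℤ using (ℤ; +_; -[1+_])
open import Data.Integer using () renaming (_<?_ to _<ℤ?_)
open import Data.Fin using (Fin; zero; suc; _↑ˡ_; _↑ʳ_)
open import Data.Vec using (Vec; []; _∷_)
open import Data.Fin.Subset using (Subset)
open import Data.Bool using (Bool; true; false)
open import Relation.Nullary using (does)
open import Relation.Binary.PropositionalEquality using (_≡_)

data PM : Set where
  minus plus : PM

toℤ : PM → ℤ
toℤ minus = -[1+ 0 ]
toℤ plus  = + 1

_·_ : PM → PM → PM
minus · minus = plus
minus · plus  = minus
plus  · y     = y

maj3 : PM → PM → PM → PM
maj3 a b c with does ((toℤ a ℤ.+ toℤ b ℤ.+ toℤ c) <ℤ? + 0)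
... | true  = minus
... | false = plus

-- MAJ_3^{⊗k} : {-1,1}^{3^k} → {-1,1}, for k ≥ 1 (k = 0 is an unused filler).
-- 3 ^ suc k reduces to N + (N + (N + 0)) with N = 3 ^ k; the three blocks are
-- coordinates 1..N, N+1..2N, 2N+1..3N.
majIter : (k : ℕ) → (Fin (3 ^ k) → PM) → PM
majIter zero x = x zero
majIter (suc zero) x = maj3 (x zero) (x (suc zero)) (x (suc (suc zero)))
majIter (suc (suc k)) x =
  maj3 (majIter (suc k) (λ i → x (i ↑ˡ (N + (N + 0)))))
       (majIter (suc k) (λ i → x (N ↑ʳ (i ↑ˡ (N + 0)))))
       (majIter (suc k) (λ i → x (N ↑ʳ (N ↑ʳ (i ↑ˡ 0)))))
  where N = 3 ^ suc k

parity : {n : ℕ} → Subset n → (Fin n → PM) → PM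
parity [] x = plus
parity (true  ∷ S) x = x zero · parity S (λ i → x (suc i))
parity (false ∷ S) x = parity S (λ i → x (suc i))

data PDT (n : ℕ) : Set where
  leaf : PM → PDT n
  node : Subset n → (onMinus onPlus : PDT n) → PDT n

eval : {n : ℕ} → PDT n → (Fin n → PM) → PM
eval (leaf v) x = v
eval (node S t₋ t₊) x with parity S x
... | minus = eval t₋ x
... | plus  = eval t₊ x

depth : {n : ℕ} → PDT n → ℕ
depth (leaf _) = 0
depth (node _ t₋ t₊) = suc (depth t₋ ⊔ depth t₊)

Computes : {n : ℕ} → PDT n → ((Fin n → PM) → PM) → Set
Computes t f = ∀ x → eval t x ≡ f x

module Submission where

-- Lower bound on the parity decision tree depth of recursive majority, via
-- Fourier sparsity (number of nonzero coefficients of the multilinear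
-- representation over {-1,1}).
--
-- The representation is unique,
--    so every nonzero multiple of a function f has the same sparsity.
-- 2. TreeRepresentation: if a parity decision tree of depth d computes f, then
--    2^d·f has a representation with at most 4^d monomials, since at a node
--    2·t(x) = (t₊ + t₋) + χ_S(x)·(t₊ − t₋).  Hence sparsity(f) ≤ 4^depth.
-- 3. MajorityComposition: from 2·MAJ₃(a,b,c) = a + b + c − abc, composing a
--    function of sparsity s with MAJ₃ gives sparsity ≥ s³ − 3s; starting from
--    sparsity(MAJ₃) = 4 this yields sparsity(MAJ₃^{⊗(j+1)}) ≥ 2·2^(3^j).
-- 4. Arithmetic: 2·2^(3^j) ≤ 4^d forces 3^j < 2d, which gives
--    9^k ≤ 6·4^k·d for k = j + 1.
-- The theorem follows with the constant c = 1/6.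

open import Defs
open import Data.Product using (Σ; _×_; _,_)

module Arithmetic where

  open import Data.Nat using (ℕ; zero; suc; _+_; _*_; _^_; _≤_; _<_; z≤n; s≤s)
  open import Data.Nat.Properties
  open import Data.Nat.Tactic.RingSolver using (solve-∀)
  open import Data.Empty using (⊥-elim)
  open import Relation.Nullary using (yes; no)
  open import Relation.Binary.PropositionalEquality using (_≡_; refl; cong; module ≡-Reasoning)

  cube-gap : ∀ s P → 1 ≤ P → 2 * P ≤ s → (s + (s + s)) + 2 * (P * (P * P)) ≤ s * (s * s)
  cube-gap s P 1≤P 2P≤s = begin
    (s + (s + s)) + 2 * (P * (P * P)) ≡⟨ regroup s P ⟩
    2 * P * P * P + 3 * s * 1 * 1     ≤⟨ +-mono-≤ (*-monoˡ-≤ P (*-monoˡ-≤ P 2P≤s))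
                                                  (*-mono-≤ (*-monoʳ-≤ (3 * s) 1≤P) 1≤P) ⟩
    s * P * P + 3 * s * P * P         ≡⟨ expand s P ⟩
    s * (2 * P) * (2 * P)             ≤⟨ *-mono-≤ (*-monoʳ-≤ s 2P≤s) 2P≤s ⟩
    s * s * s                         ≡⟨ *-assoc s s s ⟩
    s * (s * s)                       ∎
    where
    open ≤-Reasoning
    regroup : ∀ s P → (s + (s + s)) + 2 * (P * (P * P)) ≡ 2 * P * P * P + 3 * s * 1 * 1
    regroup = solve-∀
    expand : ∀ s P → s * P * P + 3 * s * P * P ≡ s * (2 * P) * (2 * P)
    expand = solve-∀

  two-pow-triple : ∀ a → 2 ^ (a + (a + (a + 0))) ≡ 2 ^ a * (2 ^ a * 2 ^ a)
  two-pow-triple a = begin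
    2 ^ (a + (a + (a + 0)))     ≡⟨ ^-distribˡ-+-* 2 a _ ⟩
    2 ^ a * 2 ^ (a + (a + 0))   ≡⟨ cong (2 ^ a *_) (^-distribˡ-+-* 2 a _) ⟩
    2 ^ a * (2 ^ a * 2 ^ (a + 0)) ≡⟨ cong (λ e → 2 ^ a * (2 ^ a * 2 ^ e)) (+-identityʳ a) ⟩
    2 ^ a * (2 ^ a * 2 ^ a)     ∎
    where open ≡-Reasoning

  exponent-bound : ∀ m d → 2 * 2 ^ m ≤ 4 ^ d → m < 2 * d
  exponent-bound m d h with m <? 2 * d
  ... | yes m<2d = m<2d
  ... | no m≮2d = ⊥-elim (<⇒≱ 2^m<2^[1+m] (≤-trans h 4^d≤2^m))
    where
    4^d≤2^m : 4 ^ d ≤ 2 ^ m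
    4^d≤2^m = ≤-trans (≤-reflexive (^-*-assoc 2 2 d)) (^-monoʳ-≤ 2 (≮⇒≥ m≮2d))
    2^m<2^[1+m] : 2 ^ m < 2 ^ suc m
    2^m<2^[1+m] = ^-monoʳ-< 2 (s≤s (s≤s z≤n)) (n<1+n m)

  nine≡three² : ∀ j → 9 ^ j ≡ 3 ^ j * 3 ^ j
  nine≡three² zero = refl
  nine≡three² (suc j) = begin
    9 * 9 ^ j                 ≡⟨ cong (9 *_) (nine≡three² j) ⟩
    9 * (3 ^ j * 3 ^ j)       ≡⟨ regroup (3 ^ j) ⟩
    3 * 3 ^ j * (3 * 3 ^ j)   ∎
    where
    open ≡-Reasoning
    regroup : ∀ a → 9 * (a * a) ≡ 3 * a * (3 * a)
    regroup = solve-∀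

  nine-fourths-bound : ∀ j d → 3 ^ j < 2 * d → 9 ^ suc j ≤ 6 * 4 ^ suc j * d
  nine-fourths-bound j d 3^j<2d = begin
    9 ^ suc j ≡⟨ cong (9 *_) (nine≡three² j) ⟩
    9 * (3 ^ j * 3 ^ j) ≤⟨ *-monoʳ-≤ 9 (*-mono-≤ (^-monoˡ-≤ j (s≤s (s≤s (s≤s z≤n)))) (<⇒≤ 3^j<2d)) ⟩
    9 * (4 ^ j * (2 * d)) ≤⟨ m≤m+n _ (6 * (4 ^ j * d)) ⟩
    9 * (4 ^ j * (2 * d)) + 6 * (4 ^ j * d) ≡⟨ regroup (4 ^ j) d ⟩
    6 * 4 ^ suc j * d ∎
    where
    open ≤-Reasoning
    regroup : ∀ a d → 9 * (a * (2 * d)) + 6 * (a * d) ≡ 6 * (4 * a) * d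
    regroup = solve-∀

module Polynomials where

  open import Data.Nat as ℕ using (ℕ; zero; suc)
  open import Data.Nat.Properties as ℕₚ using ()
  open import Data.Integer using (ℤ; +_; _+_; _*_; -_; 0ℤ; 1ℤ; -1ℤ)
  open import Data.Integer.Properties using (_≟_; +-identityˡ; +-identityʳ; *-identityˡ; *-zeroˡ; *-zeroʳ; *-cancelˡ-≡; i*j≡0⇒i≡0∨j≡0)
  open import Data.Integer.Tactic.RingSolver using (solve-∀)
  open import Data.Fin using (Fin; zero; suc; _↑ˡ_; _↑ʳ_)
  open import Data.Vec using ([]; _∷_)
  open import Data.Fin.Subset using (Subset)
  open import Data.Bool using (true; false)
  open import Data.Sum using ([_,_]′)
  open import Data.Empty using (⊥-elim)
  open import Relation.Nullary using (yes; no; ¬_)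
  open import Relation.Binary.PropositionalEquality
  import Data.Nat.Tactic.RingSolver as ℕ-Solver

  -- A multilinear polynomial with integer coefficients in n variables, in the
  -- recursive form p = p₀ + x₀ · p₁ with p₀, p₁ in the remaining variables.
  Poly : ℕ → Set
  Poly zero    = ℤ
  Poly (suc n) = Poly n × Poly n

  rest : ∀ {n} → (Fin (suc n) → PM) → Fin n → PM
  rest x i = x (suc i)

  evalP : ∀ {n} → Poly n → (Fin n → PM) → ℤ
  evalP {zero}  c       x = c
  evalP {suc n} (p , q) x = evalP p (rest x) + toℤ (x zero) * evalP q (rest x)

  nz : ℤ → ℕ
  nz c with c ≟ 0ℤ
  ... | yes _ = 0
  ... | no  _ = 1

  sparsity : ∀ {n} → Poly n → ℕ
  sparsity {zero}  c       = nz c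
  sparsity {suc n} (p , q) = sparsity p ℕ.+ sparsity q

  _⊕_ : ∀ {n} → Poly n → Poly n → Poly n
  _⊕_ {zero}  c       d         = c + d
  _⊕_ {suc n} (p , q) (p' , q') = p ⊕ p' , q ⊕ q'

  scale : ∀ {n} → ℤ → Poly n → Poly n
  scale {zero}  c d       = c * d
  scale {suc n} c (p , q) = scale c p , scale c q

  zeroP : ∀ {n} → Poly n
  zeroP {zero}  = 0ℤ
  zeroP {suc n} = zeroP , zeroP

  constP : ∀ {n} → ℤ → Poly n
  constP {zero}  c = c
  constP {suc n} c = constP c , zeroP

  -- χ_S · p: when x₀ ∈ S the halves swap, as x₀ · (p₀ + x₀ p₁) = p₁ + x₀ p₀.
  mulχ : ∀ {n} → Subset n → Poly n → Poly n
  mulχ []          c       = c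
  mulχ (true  ∷ S) (p , q) = mulχ S q , mulχ S p
  mulχ (false ∷ S) (p , q) = mulχ S p , mulχ S q

  liftˡ : ∀ {a b} → Poly a → Poly (a ℕ.+ b)
  liftˡ {zero}  c        = constP c
  liftˡ {suc a} (p , p') = liftˡ p , liftˡ p'

  liftʳ : ∀ {a b} → Poly b → Poly (a ℕ.+ b)
  liftʳ {zero}  q = q
  liftʳ {suc a} q = liftʳ q , zeroP

  tensor : ∀ {a b} → Poly a → Poly b → Poly (a ℕ.+ b)
  tensor {zero}  c        q = scale c q
  tensor {suc a} (p , p') q = tensor p q , tensor p' q

  eval-zero : ∀ {n} (x : Fin n → PM) → evalP (zeroP {n}) x ≡ 0ℤ
  eval-zero {zero}  x = refl
  eval-zero {suc n} x rewrite eval-zero (rest x) = trans (+-identityˡ _) (*-zeroʳ (toℤ (x zero)))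

  eval-const : ∀ {n} c (x : Fin n → PM) → evalP (constP {n} c) x ≡ c
  eval-const {zero}  c x = refl
  eval-const {suc n} c x rewrite eval-const c (rest x) | eval-zero (rest x)
                                | *-zeroʳ (toℤ (x zero)) = +-identityʳ c

  eval-⊕ : ∀ {n} (p q : Poly n) x → evalP (p ⊕ q) x ≡ evalP p x + evalP q x
  eval-⊕ {zero}  p        q        x = refl
  eval-⊕ {suc n} (p , p') (q , q') x
    rewrite eval-⊕ p q (rest x) | eval-⊕ p' q' (rest x) =
      regroup (evalP p (rest x)) (evalP p' (rest x)) (evalP q (rest x)) (evalP q' (rest x)) (toℤ (x zero))
    where
    regroup : ∀ a b c d e → (a + c) + e * (b + d) ≡ (a + e * b) + (c + e * d)
    regroup = solve-∀

  eval-scale : ∀ {n} c (p : Poly n) x → evalP (scale c p) x ≡ c * evalP p x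
  eval-scale {zero}  c p       x = refl
  eval-scale {suc n} c (p , q) x
    rewrite eval-scale c p (rest x) | eval-scale c q (rest x) =
      factor c (evalP p (rest x)) (evalP q (rest x)) (toℤ (x zero))
    where
    factor : ∀ c a b e → c * a + e * (c * b) ≡ c * (a + e * b)
    factor = solve-∀

  toℤ-· : ∀ a b → toℤ (a · b) ≡ toℤ a * toℤ b
  toℤ-· minus minus = refl
  toℤ-· minus plus  = refl
  toℤ-· plus  minus = refl
  toℤ-· plus  plus  = refl

  toℤ-square : ∀ a → toℤ a * toℤ a ≡ 1ℤ
  toℤ-square minus = refl
  toℤ-square plus  = refl

  eval-mulχ : ∀ {n} (S : Subset n) (p : Poly n) x →
    evalP (mulχ S p) x ≡ toℤ (parity S x) * evalP p x
  eval-mulχ []          p       x = sym (*-identityˡ p)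
  eval-mulχ (true  ∷ S) (p , q) x
    rewrite eval-mulχ S p (rest x) | eval-mulχ S q (rest x)
          | toℤ-· (x zero) (parity S (rest x)) =
      swap-halves (toℤ (parity S (rest x))) (evalP p (rest x)) (evalP q (rest x)) (toℤ (x zero)) (toℤ-square (x zero))
    where
    swap-halves : ∀ s a b e → e * e ≡ 1ℤ → s * b + e * (s * a) ≡ (e * s) * (a + e * b)
    swap-halves s a b e e²≡1 = begin
      s * b + e * (s * a)         ≡⟨ expand₁ s a b e ⟩
      e * s * a + 1ℤ * s * b      ≡⟨ cong (λ u → e * s * a + u * s * b) (sym e²≡1) ⟩
      e * s * a + (e * e) * s * b ≡⟨ expand₂ s a b e ⟩
      (e * s) * (a + e * b)       ∎
      where
      open ≡-Reasoning
      expand₁ : ∀ s a b e → s * b + e * (s * a) ≡ e * s * a + 1ℤ * s * b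
      expand₁ = solve-∀
      expand₂ : ∀ s a b e → e * s * a + (e * e) * s * b ≡ (e * s) * (a + e * b)
      expand₂ = solve-∀
  eval-mulχ (false ∷ S) (p , q) x
    rewrite eval-mulχ S p (rest x) | eval-mulχ S q (rest x) =
      factor (toℤ (parity S (rest x))) (evalP p (rest x)) (evalP q (rest x)) (toℤ (x zero))
    where
    factor : ∀ s a b e → s * a + e * (s * b) ≡ s * (a + e * b)
    factor = solve-∀

  eval-liftˡ : ∀ {a b} (p : Poly a) x → evalP (liftˡ {a} {b} p) x ≡ evalP p (λ i → x (i ↑ˡ b))
  eval-liftˡ {zero}  c        x = eval-const c x
  eval-liftˡ {suc a} (p , p') x rewrite eval-liftˡ p (rest x) | eval-liftˡ p' (rest x) = refl

  eval-liftʳ : ∀ {a b} (q : Poly b) x → evalP (liftʳ {a} {b} q) x ≡ evalP q (λ i → x (a ↑ʳ i))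
  eval-liftʳ {zero}  q x = refl
  eval-liftʳ {suc a} q x rewrite eval-liftʳ {a} q (rest x) | eval-zero (rest x)
                               | *-zeroʳ (toℤ (x zero)) = +-identityʳ _

  eval-tensor : ∀ {a b} (p : Poly a) (q : Poly b) x →
    evalP (tensor p q) x ≡ evalP p (λ i → x (i ↑ˡ b)) * evalP q (λ i → x (a ↑ʳ i))
  eval-tensor {zero}      c        q x = eval-scale c q x
  eval-tensor {suc a} {b} (p , p') q x
    rewrite eval-tensor p q (rest x) | eval-tensor p' q (rest x) =
      factor (evalP p (λ i → x (suc (i ↑ˡ b)))) (evalP p' (λ i → x (suc (i ↑ˡ b))))
             (toℤ (x zero)) (evalP q (λ i → x (suc (a ↑ʳ i))))
    where
    factor : ∀ a b e c → a * c + e * (b * c) ≡ (a + e * b) * c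
    factor = solve-∀

  nz-zero : ∀ {c} → c ≡ 0ℤ → nz c ≡ 0
  nz-zero {c} c≡0 with c ≟ 0ℤ
  ... | yes _  = refl
  ... | no c≢0 = ⊥-elim (c≢0 c≡0)

  nz-nonzero : ∀ {c} → ¬ c ≡ 0ℤ → nz c ≡ 1
  nz-nonzero {c} c≢0 with c ≟ 0ℤ
  ... | yes c≡0 = ⊥-elim (c≢0 c≡0)
  ... | no  _   = refl

  nz≤1 : ∀ c → nz c ℕ.≤ 1
  nz≤1 c with c ≟ 0ℤ
  ... | yes _ = ℕ.z≤n
  ... | no  _ = ℕₚ.≤-refl

  *-≢0 : ∀ {c d} → ¬ c ≡ 0ℤ → ¬ d ≡ 0ℤ → ¬ c * d ≡ 0ℤ
  *-≢0 {c} c≢0 d≢0 cd≡0 = [ c≢0 , d≢0 ]′ (i*j≡0⇒i≡0∨j≡0 c cd≡0)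

  nz-* : ∀ c d → nz (c * d) ≡ nz c ℕ.* nz d
  nz-* c d with c ≟ 0ℤ | d ≟ 0ℤ
  ... | yes refl | _        = nz-zero (*-zeroˡ d)
  ... | no _     | yes refl = nz-zero (*-zeroʳ c)
  ... | no c≢0   | no d≢0   = nz-nonzero (*-≢0 c≢0 d≢0)

  nz-+ : ∀ c d → nz (c + d) ℕ.≤ nz c ℕ.+ nz d
  nz-+ c d with c ≟ 0ℤ
  ... | yes refl rewrite +-identityˡ d = ℕₚ.≤-refl
  ... | no _     = ℕₚ.≤-trans (nz≤1 (c + d)) (ℕₚ.m≤m+n 1 _)

  -- d = (c + d) − c, so d can be nonzero only if c or c + d is.
  nz-+-rev : ∀ c d → nz d ℕ.≤ nz c ℕ.+ nz (c + d)
  nz-+-rev c d with c ≟ 0ℤ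
  ... | yes refl rewrite +-identityˡ d = ℕₚ.≤-refl
  ... | no _     = ℕₚ.≤-trans (nz≤1 d) (ℕₚ.m≤m+n 1 _)

  private
    interchange : ∀ a b c d → (a ℕ.+ c) ℕ.+ (b ℕ.+ d) ≡ (a ℕ.+ b) ℕ.+ (c ℕ.+ d)
    interchange = ℕ-Solver.solve-∀

  sparsity-⊕ : ∀ {n} (p q : Poly n) → sparsity (p ⊕ q) ℕ.≤ sparsity p ℕ.+ sparsity q
  sparsity-⊕ {zero}  p        q        = nz-+ p q
  sparsity-⊕ {suc n} (p , p') (q , q') =
    ℕₚ.≤-trans (ℕₚ.+-mono-≤ (sparsity-⊕ p q) (sparsity-⊕ p' q'))
               (ℕₚ.≤-reflexive (interchange (sparsity p) (sparsity p') (sparsity q) (sparsity q')))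

  sparsity-⊕-rev : ∀ {n} (p q : Poly n) → sparsity q ℕ.≤ sparsity p ℕ.+ sparsity (p ⊕ q)
  sparsity-⊕-rev {zero}  p        q        = nz-+-rev p q
  sparsity-⊕-rev {suc n} (p , p') (q , q') =
    ℕₚ.≤-trans (ℕₚ.+-mono-≤ (sparsity-⊕-rev p q) (sparsity-⊕-rev p' q'))
               (ℕₚ.≤-reflexive (interchange (sparsity p) (sparsity p') (sparsity (p ⊕ q)) (sparsity (p' ⊕ q'))))

  sparsity-scale : ∀ {n} c (p : Poly n) → sparsity (scale c p) ≡ nz c ℕ.* sparsity p
  sparsity-scale {zero}  c p       = nz-* c p
  sparsity-scale {suc n} c (p , q) rewrite sparsity-scale c p | sparsity-scale c q =
    sym (ℕₚ.*-distribˡ-+ (nz c) (sparsity p) (sparsity q))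

  sparsity-scale-≤ : ∀ {n} c (p : Poly n) → sparsity (scale c p) ℕ.≤ sparsity p
  sparsity-scale-≤ c p = ℕₚ.≤-trans (ℕₚ.≤-reflexive (sparsity-scale c p))
    (ℕₚ.≤-trans (ℕₚ.*-monoˡ-≤ (sparsity p) (nz≤1 c)) (ℕₚ.≤-reflexive (ℕₚ.+-identityʳ (sparsity p))))

  sparsity-scale-nonzero : ∀ {n} c (p : Poly n) → ¬ c ≡ 0ℤ → sparsity (scale c p) ≡ sparsity p
  sparsity-scale-nonzero c p c≢0 = trans (sparsity-scale c p)
    (trans (cong (ℕ._* sparsity p) (nz-nonzero c≢0)) (ℕₚ.+-identityʳ (sparsity p)))

  sparsity-zero : ∀ {n} → sparsity (zeroP {n}) ≡ 0
  sparsity-zero {zero}  = refl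
  sparsity-zero {suc n} rewrite sparsity-zero {n} = refl

  sparsity-const : ∀ {n} c → sparsity (constP {n} c) ≡ nz c
  sparsity-const {zero}  c = refl
  sparsity-const {suc n} c rewrite sparsity-const {n} c | sparsity-zero {n} = ℕₚ.+-identityʳ (nz c)

  sparsity-mulχ : ∀ {n} (S : Subset n) (p : Poly n) → sparsity (mulχ S p) ≡ sparsity p
  sparsity-mulχ []          p       = refl
  sparsity-mulχ (true  ∷ S) (p , q) rewrite sparsity-mulχ S p | sparsity-mulχ S q =
    ℕₚ.+-comm (sparsity q) (sparsity p)
  sparsity-mulχ (false ∷ S) (p , q) rewrite sparsity-mulχ S p | sparsity-mulχ S q = refl

  sparsity-liftˡ : ∀ {a b} (p : Poly a) → sparsity (liftˡ {a} {b} p) ≡ sparsity p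
  sparsity-liftˡ {zero}  {b} c        = sparsity-const {b} c
  sparsity-liftˡ {suc a} {b} (p , p') rewrite sparsity-liftˡ {a} {b} p | sparsity-liftˡ {a} {b} p' = refl

  sparsity-liftʳ : ∀ {a b} (q : Poly b) → sparsity (liftʳ {a} {b} q) ≡ sparsity q
  sparsity-liftʳ {zero}      q = refl
  sparsity-liftʳ {suc a} {b} q rewrite sparsity-liftʳ {a} q | sparsity-zero {a ℕ.+ b} = ℕₚ.+-identityʳ (sparsity q)

  sparsity-tensor : ∀ {a b} (p : Poly a) (q : Poly b) → sparsity (tensor p q) ≡ sparsity p ℕ.* sparsity q
  sparsity-tensor {zero}  c        q = sparsity-scale c q
  sparsity-tensor {suc a} (p , p') q rewrite sparsity-tensor p q | sparsity-tensor p' q =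
    sym (ℕₚ.*-distribʳ-+ (sparsity q) (sparsity p) (sparsity p'))

  -- Uniqueness of the multilinear representation: a polynomial is determined by
  -- its values on {-1,1}ⁿ.  Evaluating at x₀ = ±1 recovers 2p₀ and 2p₁.
  evalP-injective : ∀ {n} (p q : Poly n) → (∀ x → evalP p x ≡ evalP q x) → p ≡ q
  evalP-injective {zero}  p        q        same = same (λ ())
  evalP-injective {suc n} (p , p') (q , q') same =
    cong₂ _,_ (evalP-injective p q same₀) (evalP-injective p' q' same₁)
    where
    _◂_ : PM → (Fin n → PM) → Fin (suc n) → PM
    (v ◂ y) zero    = v
    (v ◂ y) (suc i) = y i
    sum-halves : ∀ a b → + 2 * a ≡ (a + 1ℤ * b) + (a + -1ℤ * b)
    sum-halves = solve-∀
    diff-halves : ∀ a b → + 2 * b ≡ (a + 1ℤ * b) + - (a + -1ℤ * b)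
    diff-halves = solve-∀
    same₀ : ∀ y → evalP p y ≡ evalP q y
    same₀ y = *-cancelˡ-≡ (+ 2) _ _ (begin
      + 2 * evalP p y                            ≡⟨ sum-halves (evalP p y) (evalP p' y) ⟩
      evalP (p , p') (plus ◂ y) + evalP (p , p') (minus ◂ y) ≡⟨ cong₂ _+_ (same (plus ◂ y)) (same (minus ◂ y)) ⟩
      evalP (q , q') (plus ◂ y) + evalP (q , q') (minus ◂ y) ≡⟨ sym (sum-halves (evalP q y) (evalP q' y)) ⟩
      + 2 * evalP q y                            ∎)
      where open ≡-Reasoning
    same₁ : ∀ y → evalP p' y ≡ evalP q' y
    same₁ y = *-cancelˡ-≡ (+ 2) _ _ (begin
      + 2 * evalP p' y                           ≡⟨ diff-halves (evalP p y) (evalP p' y) ⟩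
      evalP (p , p') (plus ◂ y) + - evalP (p , p') (minus ◂ y) ≡⟨ cong₂ (λ u v → u + - v) (same (plus ◂ y)) (same (minus ◂ y)) ⟩
      evalP (q , q') (plus ◂ y) + - evalP (q , q') (minus ◂ y) ≡⟨ sym (diff-halves (evalP q y) (evalP q' y)) ⟩
      + 2 * evalP q' y                           ∎)
      where open ≡-Reasoning

  Represents : ∀ {n} → Poly n → ((Fin n → PM) → PM) → ℤ → Set
  Represents p f c = ∀ x → evalP p x ≡ c * toℤ (f x)

  sparsity-invariant : ∀ {n} {f : (Fin n → PM) → PM} {p q : Poly n} {c d : ℤ} →
    Represents p f c → Represents q f d → ¬ c ≡ 0ℤ → ¬ d ≡ 0ℤ → sparsity p ≡ sparsity q
  sparsity-invariant {f = f} {p} {q} {c} {d} rep-p rep-q c≢0 d≢0 = begin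
    sparsity p           ≡⟨ sym (sparsity-scale-nonzero d p d≢0) ⟩
    sparsity (scale d p) ≡⟨ cong sparsity (evalP-injective (scale d p) (scale c q) same) ⟩
    sparsity (scale c q) ≡⟨ sparsity-scale-nonzero c q c≢0 ⟩
    sparsity q           ∎
    where
    open ≡-Reasoning
    commute : ∀ d c v → d * (c * v) ≡ c * (d * v)
    commute = solve-∀
    same : ∀ x → evalP (scale d p) x ≡ evalP (scale c q) x
    same x = begin
      evalP (scale d p) x     ≡⟨ eval-scale d p x ⟩
      d * evalP p x           ≡⟨ cong (d *_) (rep-p x) ⟩
      d * (c * toℤ (f x))     ≡⟨ commute d c (toℤ (f x)) ⟩
      c * (d * toℤ (f x))     ≡⟨ cong (c *_) (sym (rep-q x)) ⟩
      c * evalP q x           ≡⟨ sym (eval-scale c q x) ⟩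
      evalP (scale c q) x     ∎

module TreeRepresentation where

  open Polynomials
  open import Data.Nat as ℕ using (ℕ; suc; _^_; s≤s)
  open import Data.Nat.Properties as ℕₚ using ()
  open import Data.Integer using (ℤ; +_; _+_; _*_; 0ℤ; 1ℤ; -1ℤ)
  open import Data.Integer.Properties using (pos-*; +-injective)
  open import Data.Fin using (Fin)
  open import Relation.Nullary using (¬_)
  import Data.Nat.Tactic.RingSolver as ℕ-Solver
  open import Data.Integer.Tactic.RingSolver using (solve-∀)
  open import Data.Fin.Subset using (Subset)
  open import Relation.Binary.PropositionalEquality

  -- At a node querying χ_S with subtrees scaled by P:
  --   2P·t(x) = (P·t₊ + P·t₋) + χ_S(x)·(P·t₊ − P·t₋).
  nodeP : ∀ {n} → Subset n → (p₋ p₊ : Poly n) → Poly n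
  nodeP S p₋ p₊ = (p₊ ⊕ p₋) ⊕ mulχ S (p₊ ⊕ scale -1ℤ p₋)

  eval-nodeP : ∀ {n} S (p₋ p₊ : Poly n) x →
    evalP (nodeP S p₋ p₊) x ≡ (evalP p₊ x + evalP p₋ x) + toℤ (parity S x) * (evalP p₊ x + -1ℤ * evalP p₋ x)
  eval-nodeP S p₋ p₊ x = begin
    evalP (nodeP S p₋ p₊) x
      ≡⟨ eval-⊕ (p₊ ⊕ p₋) _ x ⟩
    evalP (p₊ ⊕ p₋) x + evalP (mulχ S (p₊ ⊕ scale -1ℤ p₋)) x
      ≡⟨ cong₂ _+_ (eval-⊕ p₊ p₋ x) (eval-mulχ S _ x) ⟩
    (evalP p₊ x + evalP p₋ x) + toℤ (parity S x) * evalP (p₊ ⊕ scale -1ℤ p₋) x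
      ≡⟨ cong (λ v → (evalP p₊ x + evalP p₋ x) + toℤ (parity S x) * v)
              (trans (eval-⊕ p₊ _ x) (cong (λ v → evalP p₊ x + v) (eval-scale -1ℤ p₋ x))) ⟩
    (evalP p₊ x + evalP p₋ x) + toℤ (parity S x) * (evalP p₊ x + -1ℤ * evalP p₋ x) ∎
    where open ≡-Reasoning

  sparsity-nodeP : ∀ {n} S (p₋ p₊ : Poly n) →
    sparsity (nodeP S p₋ p₊) ℕ.≤ (sparsity p₊ ℕ.+ sparsity p₋) ℕ.+ (sparsity p₊ ℕ.+ sparsity p₋)
  sparsity-nodeP S p₋ p₊ =
    ℕₚ.≤-trans (sparsity-⊕ (p₊ ⊕ p₋) _)
      (ℕₚ.+-mono-≤ (sparsity-⊕ p₊ p₋)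
        (ℕₚ.≤-trans (ℕₚ.≤-reflexive (sparsity-mulχ S _))
          (ℕₚ.≤-trans (sparsity-⊕ p₊ _) (ℕₚ.+-monoʳ-≤ (sparsity p₊) (sparsity-scale-≤ -1ℤ p₋)))))

  -- By induction on the tree, for any D ≥ depth t (the common scale of both
  -- subtrees): scale 2^D and at most 4^D monomials.
  tree-representation : ∀ {n} (t : PDT n) D → depth t ℕ.≤ D →
    Σ (Poly n) λ p → Represents p (eval t) (+ (2 ^ D)) × sparsity p ℕ.≤ 4 ^ D
  tree-representation {n} (leaf v) D _ =
    constP c , (λ x → eval-const c x) ,
    ℕₚ.≤-trans (ℕₚ.≤-reflexive (sparsity-const {n} c)) (ℕₚ.≤-trans (nz≤1 c) (ℕₚ.m^n>0 4 D))
    where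
    c : ℤ
    c = + (2 ^ D) * toℤ v
  tree-representation (node S t₋ t₊) (suc D) (s≤s depth≤D)
    with tree-representation t₋ D (ℕₚ.≤-trans (ℕₚ.m≤m⊔n (depth t₋) (depth t₊)) depth≤D)
       | tree-representation t₊ D (ℕₚ.≤-trans (ℕₚ.m≤n⊔m (depth t₋) (depth t₊)) depth≤D)
  ... | p₋ , rep₋ , sparse₋ | p₊ , rep₊ , sparse₊ = nodeP S p₋ p₊ , represents , sparse
    where
    P : ℤ
    P = + (2 ^ D)
    doubled : + (2 ^ suc D) ≡ + 2 * P
    doubled = pos-* 2 (2 ^ D)
    select₊ : ∀ P a b → (P * a + P * b) + 1ℤ * (P * a + -1ℤ * (P * b)) ≡ (+ 2 * P) * a
    select₊ = solve-∀
    select₋ : ∀ P a b → (P * a + P * b) + -1ℤ * (P * a + -1ℤ * (P * b)) ≡ (+ 2 * P) * b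
    select₋ = solve-∀
    represents : Represents (nodeP S p₋ p₊) (eval (node S t₋ t₊)) (+ (2 ^ suc D))
    represents x rewrite eval-nodeP S p₋ p₊ x | rep₋ x | rep₊ x with parity S x
    ... | plus  = trans (select₊ P _ _) (cong (_* toℤ (eval t₊ x)) (sym doubled))
    ... | minus = trans (select₋ P _ _) (cong (_* toℤ (eval t₋ x)) (sym doubled))
    four-copies : ∀ a → (a ℕ.+ a) ℕ.+ (a ℕ.+ a) ≡ 4 ℕ.* a
    four-copies = ℕ-Solver.solve-∀
    sparse : sparsity (nodeP S p₋ p₊) ℕ.≤ 4 ^ suc D
    sparse = ℕₚ.≤-trans (sparsity-nodeP S p₋ p₊)
      (ℕₚ.≤-trans (ℕₚ.+-mono-≤ (ℕₚ.+-mono-≤ sparse₊ sparse₋) (ℕₚ.+-mono-≤ sparse₊ sparse₋))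
                  (ℕₚ.≤-reflexive (four-copies (4 ^ D))))

  sparsity≤4^depth : ∀ {n} {f : (Fin n → PM) → PM} (t : PDT n) → Computes t f →
    ∀ {M : Poly n} {E : ℤ} → Represents M f E → ¬ E ≡ 0ℤ → sparsity M ℕ.≤ 4 ^ depth t
  sparsity≤4^depth {f = f} t computes represents E≢0 with tree-representation t (depth t) ℕₚ.≤-refl
  ... | p , represents-t , sparse =
    ℕₚ.≤-trans (ℕₚ.≤-reflexive (sparsity-invariant represents represents-f E≢0 2^d≢0)) sparse
    where
    represents-f : Represents p f (+ (2 ^ depth t))
    represents-f x = trans (represents-t x) (cong (λ v → + (2 ^ depth t) * toℤ v) (computes x))
    2^d≢0 : ¬ + (2 ^ depth t) ≡ 0ℤ
    2^d≢0 eq = ℕₚ.<⇒≢ (ℕₚ.m^n>0 2 (depth t)) (sym (+-injective eq))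

-- Majority composition: from a representation Y of g with scale E on N variables,
-- build one of x ↦ MAJ₃(g(x¹), g(x²), g(x³)) on 3N variables via
-- 2·MAJ₃(a,b,c) = a + b + c − abc; its sparsity is at least s³ − 3s for
-- s = sparsity Y.
module MajorityComposition where

  open Polynomials
  open Arithmetic using (cube-gap; two-pow-triple)
  open import Data.Nat as ℕ using (ℕ; zero; suc; _^_)
  open import Data.Nat.Properties as ℕₚ using ()
  open import Data.Integer using (ℤ; +_; _+_; _*_; 0ℤ; 1ℤ; -1ℤ)
  open import Data.Integer.Tactic.RingSolver using (solve-∀)
  open import Data.Fin using (Fin; zero; _↑ˡ_; _↑ʳ_)
  open import Relation.Nullary using (¬_)
  open import Relation.Binary.PropositionalEquality

  maj3-polynomial : ∀ a b c → + 2 * toℤ (maj3 a b c) ≡ toℤ a + toℤ b + toℤ c + -1ℤ * (toℤ a * toℤ b * toℤ c)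
  maj3-polynomial minus minus minus = refl
  maj3-polynomial minus minus plus  = refl
  maj3-polynomial minus plus  minus = refl
  maj3-polynomial minus plus  plus  = refl
  maj3-polynomial plus  minus minus = refl
  maj3-polynomial plus  minus plus  = refl
  maj3-polynomial plus  plus  minus = refl
  maj3-polynomial plus  plus  plus  = refl

  module _ {N : ℕ} (Y : Poly N) (E : ℤ) where

    block₁ block₂ block₃ linear cube : Poly (N ℕ.+ (N ℕ.+ (N ℕ.+ 0)))
    block₁ = liftˡ Y
    block₂ = liftʳ {N} (liftˡ Y)
    block₃ = liftʳ {N} (liftʳ {N} (liftˡ Y))
    linear = scale (E * E) (block₁ ⊕ (block₂ ⊕ block₃))
    cube   = tensor Y (tensor Y (liftˡ Y))

    compose : Poly (N ℕ.+ (N ℕ.+ (N ℕ.+ 0)))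
    compose = linear ⊕ scale -1ℤ cube

    compose-represents : ∀ {g : (Fin N → PM) → PM} → Represents Y g E →
      Represents compose
        (λ x → maj3 (g (λ i → x (i ↑ˡ (N ℕ.+ (N ℕ.+ 0)))))
                    (g (λ i → x (N ↑ʳ (i ↑ˡ (N ℕ.+ 0)))))
                    (g (λ i → x (N ↑ʳ (N ↑ʳ (i ↑ˡ 0))))))
        (+ 2 * (E * E * E))
    compose-represents {g} rep x = begin
      evalP compose x
        ≡⟨ eval-⊕ linear _ x ⟩
      evalP linear x + evalP (scale -1ℤ cube) x
        ≡⟨ cong₂ _+_ (trans (eval-scale (E * E) _ x) (cong (E * E *_) blocks))
                     (trans (eval-scale -1ℤ cube x) (cong (-1ℤ *_) product)) ⟩
      E * E * (E * a + (E * b + E * c)) + -1ℤ * (E * a * (E * b * (E * c)))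
        ≡⟨ factor E a b c ⟩
      E * E * E * (a + b + c + -1ℤ * (a * b * c))
        ≡⟨ cong (E * E * E *_) (sym (maj3-polynomial (g x₁) (g x₂) (g x₃))) ⟩
      E * E * E * (+ 2 * toℤ (maj3 (g x₁) (g x₂) (g x₃)))
        ≡⟨ reassociate (E * E * E) (toℤ (maj3 (g x₁) (g x₂) (g x₃))) ⟩
      + 2 * (E * E * E) * toℤ (maj3 (g x₁) (g x₂) (g x₃)) ∎
      where
      open ≡-Reasoning
      x₁ x₂ x₃ : Fin N → PM
      x₁ i = x (i ↑ˡ (N ℕ.+ (N ℕ.+ 0)))
      x₂ i = x (N ↑ʳ (i ↑ˡ (N ℕ.+ 0)))
      x₃ i = x (N ↑ʳ (N ↑ʳ (i ↑ˡ 0)))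
      a b c : ℤ
      a = toℤ (g x₁)
      b = toℤ (g x₂)
      c = toℤ (g x₃)
      blocks : evalP (block₁ ⊕ (block₂ ⊕ block₃)) x ≡ E * a + (E * b + E * c)
      blocks = trans (eval-⊕ block₁ _ x)
        (cong₂ _+_ (trans (eval-liftˡ Y x) (rep x₁))
          (trans (eval-⊕ block₂ block₃ x)
            (cong₂ _+_ (trans (eval-liftʳ {N} _ x) (trans (eval-liftˡ Y _) (rep x₂)))
                       (trans (eval-liftʳ {N} _ x) (trans (eval-liftʳ {N} _ _)
                         (trans (eval-liftˡ Y _) (rep x₃)))))))
      product : evalP cube x ≡ E * a * (E * b * (E * c))
      product = trans (eval-tensor Y _ x)
        (cong₂ _*_ (rep x₁) (trans (eval-tensor Y _ _)
          (cong₂ _*_ (rep x₂) (trans (eval-liftˡ Y _) (rep x₃)))))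
      factor : ∀ E a b c → E * E * (E * a + (E * b + E * c)) + -1ℤ * (E * a * (E * b * (E * c)))
                           ≡ E * E * E * (a + b + c + -1ℤ * (a * b * c))
      factor = solve-∀
      reassociate : ∀ e m → e * (+ 2 * m) ≡ + 2 * e * m
      reassociate = solve-∀

    -- The cube term has s³ monomials and the block terms at most 3s, so at most 3s
    -- of the cube's monomials can cancel.
    compose-sparsity : sparsity Y ℕ.* (sparsity Y ℕ.* sparsity Y)
                       ℕ.≤ (sparsity Y ℕ.+ (sparsity Y ℕ.+ sparsity Y)) ℕ.+ sparsity compose
    compose-sparsity = begin
      s ℕ.* (s ℕ.* s)                    ≡⟨ sym cube-sparsity ⟩
      sparsity (scale -1ℤ cube)          ≤⟨ sparsity-⊕-rev linear (scale -1ℤ cube) ⟩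
      sparsity linear ℕ.+ sparsity compose ≤⟨ ℕₚ.+-monoˡ-≤ (sparsity compose) linear-sparsity ⟩
      (s ℕ.+ (s ℕ.+ s)) ℕ.+ sparsity compose ∎
      where
      open ℕₚ.≤-Reasoning
      s : ℕ
      s = sparsity Y
      cube-sparsity : sparsity (scale -1ℤ cube) ≡ s ℕ.* (s ℕ.* s)
      cube-sparsity = begin-equality
        sparsity (scale -1ℤ cube)            ≡⟨ sparsity-scale-nonzero -1ℤ cube (λ ()) ⟩
        sparsity cube                        ≡⟨ sparsity-tensor Y _ ⟩
        s ℕ.* sparsity (tensor Y (liftˡ Y))  ≡⟨ cong (s ℕ.*_) (sparsity-tensor Y _) ⟩
        s ℕ.* (s ℕ.* sparsity (liftˡ {b = 0} Y)) ≡⟨ cong (λ v → s ℕ.* (s ℕ.* v)) (sparsity-liftˡ Y) ⟩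
        s ℕ.* (s ℕ.* s)                      ∎
      linear-sparsity : sparsity linear ℕ.≤ s ℕ.+ (s ℕ.+ s)
      linear-sparsity = begin
        sparsity linear                                 ≤⟨ sparsity-scale-≤ (E * E) (block₁ ⊕ (block₂ ⊕ block₃)) ⟩
        sparsity (block₁ ⊕ (block₂ ⊕ block₃))           ≤⟨ sparsity-⊕ block₁ _ ⟩
        sparsity block₁ ℕ.+ sparsity (block₂ ⊕ block₃)  ≤⟨ ℕₚ.+-monoʳ-≤ (sparsity block₁) (sparsity-⊕ block₂ block₃) ⟩
        sparsity block₁ ℕ.+ (sparsity block₂ ℕ.+ sparsity block₃)
          ≡⟨ cong₂ ℕ._+_ (sparsity-liftˡ Y)
               (cong₂ ℕ._+_ (trans (sparsity-liftʳ {N} _) (sparsity-liftˡ Y))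
                            (trans (sparsity-liftʳ {N} _) (trans (sparsity-liftʳ {N} _) (sparsity-liftˡ Y)))) ⟩
        s ℕ.+ (s ℕ.+ s) ∎

  var : Poly 1
  var = 0ℤ , 1ℤ

  var-represents : Represents var (λ x → x zero) 1ℤ
  var-represents x = identity (toℤ (x zero))
    where
    identity : ∀ a → 0ℤ + a * 1ℤ ≡ 1ℤ * a
    identity = solve-∀

  -- MAJ₃^{⊗(j+1)} has a representation with nonzero scale and at least 2·2^(3^j)
  -- monomials.  The base case is compose var 1 (sparsity 4); each further level
  -- cubes the bound, by cube-gap.
  majority-representation : ∀ j → Σ (Poly (3 ^ suc j)) λ M → Σ ℤ λ E →
    ¬ E ≡ 0ℤ × Represents M (majIter (suc j)) E × 2 ℕ.* 2 ^ (3 ^ j) ℕ.≤ sparsity M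
  majority-representation zero =
    compose var 1ℤ , + 2 * (1ℤ * 1ℤ * 1ℤ) , (λ ()) , compose-represents var 1ℤ var-represents , ℕₚ.≤-refl
  majority-representation (suc j) with majority-representation j
  ... | Y , E , E≢0 , represents , sparse =
    compose Y E , + 2 * (E * E * E) , *-≢0 {+ 2} (λ ()) (*-≢0 (*-≢0 E≢0 E≢0) E≢0) ,
    compose-represents Y E represents , growth
    where
    open ℕₚ.≤-Reasoning
    s P : ℕ
    s = sparsity Y
    P = 2 ^ (3 ^ j)
    growth : 2 ℕ.* 2 ^ (3 ^ suc j) ℕ.≤ sparsity (compose Y E)
    growth = begin
      2 ℕ.* 2 ^ (3 ^ suc j)      ≡⟨ cong (2 ℕ.*_) (two-pow-triple (3 ^ j)) ⟩
      2 ℕ.* (P ℕ.* (P ℕ.* P))    ≤⟨ ℕₚ.+-cancelˡ-≤ (s ℕ.+ (s ℕ.+ s)) _ _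
                                      (ℕₚ.≤-trans (cube-gap s P (ℕₚ.m^n>0 2 (3 ^ j)) sparse) (compose-sparsity Y E)) ⟩
      sparsity (compose Y E)     ∎

open Arithmetic using (exponent-bound; nine-fourths-bound)
open TreeRepresentation using (sparsity≤4^depth)
open MajorityComposition using (majority-representation)
open import Data.Nat using (ℕ; suc; _*_; _^_; _≤_; _>_; s≤s; z≤n)
open import Data.Nat.Properties using (≤-trans; ≤-reflexive; *-identityˡ)

theorem2 : Σ ℕ λ a → Σ ℕ λ b → (a > 0) × (b > 0) ×
    ((k : ℕ) → 1 ≤ k → (t : PDT (3 ^ k)) → Computes t (majIter k) →
    a * 9 ^ k ≤ b * 4 ^ k * depth t)
theorem2 = 1 , 6 , s≤s z≤n , s≤s z≤n , bound
  where
  bound : (k : ℕ) → 1 ≤ k → (t : PDT (3 ^ k)) → Computes t (majIter k) → 1 * 9 ^ k ≤ 6 * 4 ^ k * depth t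
  bound (suc j) _ t computes with majority-representation j
  ... | M , E , E≢0 , represents , sparse =
    ≤-trans (≤-reflexive (*-identityˡ (9 ^ suc j)))
      (nine-fourths-bound j (depth t) (exponent-bound (3 ^ j) (depth t)
        (≤-trans sparse (sparsity≤4^depth t computes represents E≢0))))
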